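{- Let $s$ be a uniformly random binary string of length $n$. Then the expected number of closed repeats in $s$ is $\Omega(n\log n)$; i.e., there are constants $c>0$ and $n_0$ such that for all $n\ge n_0$ the expected number of closed repeats in $s$ is at least $c\,n\log n$.
   Context: For a string $s$ of length $n$, $s[i\,..\,j]$ denotes the substring $s[i]\cdots s[j]$. A non-empty substring $s[i\,..\,j]$ is a closed repeat if it has an occurrence $s[i'\,..\,j']=s[i\,..\,j]$ with $i'>i$ such that $s[i\,..\,j]$ does not occur at any of the positions $i+1,\dots,i'-1$, and both (either $j'=n$ or $s[j+1]\ne s[j'+1]$) and (either $i=1$ or $s[i-1]\ne s[i'-1]$) hold. Closed repeats that are equal as strings but occur at different positions are counted as different. Logarithms are base 2. -}

module Defs where

open import Data.Bool using (Bool; true; false; _∧_; _∨_; not; if_then_else_)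
open import Data.Bool.Properties using () renaming (_≟_ to _≟ᵇ_)
open import Data.Nat using (ℕ; zero; suc; _+_; _*_; _∸_; _≡ᵇ_; _<ᵇ_)
open import Data.List using (List; []; _∷_; length; map; upTo; concatMap; filter)
open import Data.Bool.ListAction using (all; any)
open import Data.Nat.ListAction using (sum)
open import Relation.Nullary.Decidable using (⌊_⌋)

-- Binary strings are lists of Booleans; positions are 0-indexed here
-- (position k here = position k+1 in the paper).

-- character at position k (default false outside the string; only used in range)
at : List Bool → ℕ → Bool
at []       _       = false
at (b ∷ _)  zero    = b
at (_ ∷ bs) (suc k) = at bs k

eqBit : Bool → Bool → Bool
eqBit a b = ⌊ a ≟ᵇ b ⌋

allStrings : ℕ → List (List Bool)
allStrings zero    = [] ∷ []
allStrings (suc n) = concatMap (λ s → (false ∷ s) ∷ (true ∷ s) ∷ []) (allStrings n)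

occursAt : List Bool → ℕ → ℕ → ℕ → Bool
occursAt s i m p =
  ((p + m) <ᵇ suc (length s)) ∧ all (λ k → eqBit (at s (i + k)) (at s (p + k))) (upTo m)

isClosedRepeat : List Bool → ℕ → ℕ → Bool
isClosedRepeat s i m =
  not (m ≡ᵇ 0) ∧ ((i + m) <ᵇ suc (length s)) ∧
  any (λ i' →
        (i <ᵇ i')
      ∧ occursAt s i m i'
      ∧ all (λ p → not ((i <ᵇ p) ∧ (p <ᵇ i') ∧ occursAt s i m p)) (upTo (length s))
      ∧ (((i' + m) ≡ᵇ length s) ∨ not (eqBit (at s (i + m)) (at s (i' + m))))
      ∧ ((i ≡ᵇ 0) ∨ not (eqBit (at s (i ∸ 1)) (at s (i' ∸ 1)))))
    (upTo (length s))

-- number of closed repeats of s (occurrences at distinct positions counted separately)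
numClosedRepeats : List Bool → ℕ
numClosedRepeats s =
  sum (map (λ i → length (filter (λ m → isClosedRepeat s i m ≟ᵇ true) (upTo (suc (length s)))))
           (upTo (length s)))

-- total number of closed repeats over all 2^n binary strings of length n;
-- the expectation for a uniform random string is totalClosedRepeats n / 2^n
totalClosedRepeats : ℕ → ℕ
totalClosedRepeats n = sum (map numClosedRepeats (allStrings n))

{-# OPTIONS --safe #-}
module Submission where

-- Fix a start i ≥ 1 and a length m ≥ 1 with i + (2^m + 1)·m < n, and let w = s[i .. i+m-1].
-- Given w, each of the 2^m disjoint blocks of length m that follow it equals w with probability
-- 2^-m, independently, so with probability at least 1 - (1 - 2^-m)^(2^m) ≥ 1/2 one of them does,
-- and then w has a next occurrence at some i′ ≤ i + 2^m·m. Flipping the letter just before w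
-- toggles left maximality, flipping the letter just after the occurrence at i′ toggles right
-- maximality, and neither flip moves the next occurrence; so for each i′ exactly a quarter of
-- the strings whose next occurrence of w is at i′ make w a closed repeat. Hence w is a closed
-- repeat with probability at least 1/8, and summing over 1 ≤ i ≤ n/2 and 1 ≤ m ≤ ⌈log₂ n⌉/4
-- bounds the expected number of closed repeats below by ⌊n/2⌋·⌊⌈log₂ n⌉/4⌋/8.

open import Defs
open import Algebra.Properties.CommutativeSemigroup as CommutativeSemigroupProperties using ()
open import Data.Bool using (Bool; true; false; _∧_; _∨_; not; T)
open import Data.Bool.ListAction using (all; any; and)
open import Data.Bool.Properties using (T-∧; T-∨; T-≡) renaming (_≟_ to _≟ᵇ_)
open import Data.Empty using (⊥)
open import Data.List using (List; []; _∷_; _++_; length; map; applyUpTo; upTo; concatMap; filter; replicate)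
open import Data.List.Properties using (length-++; length-replicate; map-applyUpTo; map-cong-local)
import Data.List.Relation.Unary.All.Properties as All
import Data.List.Relation.Unary.Any.Properties as Any
open import Data.Nat
  using (ℕ; zero; suc; _+_; _*_; _^_; _∸_; _/_; _%_; _≤_; _<_; _<ᵇ_; _≡ᵇ_; z≤n; s≤s; z<s; s<s; NonZero)
open import Data.Nat.DivMod using (m≡m%n+[m/n]*n; m%n<n; m/n*n≤m; m≥n⇒m/n>0)
open import Data.Nat.ListAction using (sum)
open import Data.Nat.Logarithm using (⌈log₂_⌉; ⌈log₂⌉-mono-≤; ⌈log₂2^n⌉≡n)
open import Data.Nat.Properties
open import Data.Nat.Tactic.RingSolver using (solve-∀)
open import Data.Product using (∃; _×_; _,_; proj₁; proj₂)
open import Data.Sum using (_⊎_; inj₁; inj₂)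
open import Function using (_∘_; id)
open import Function.Bundles using (Equivalence)
open import Relation.Binary.PropositionalEquality
  using (_≡_; _≢_; refl; sym; trans; cong; cong₂; subst; module ≡-Reasoning)
open import Relation.Nullary using (¬_; yes; no; contradiction)
open import Relation.Nullary.Decidable using (T?)

open CommutativeSemigroupProperties +-commutativeSemigroup using (interchange)
open CommutativeSemigroupProperties *-commutativeSemigroup using (x∙yz≈y∙xz)

𝟙 : Bool → ℕ
𝟙 true  = 1
𝟙 false = 0

𝟙-true : ∀ {b} → T b → 𝟙 b ≡ 1
𝟙-true {true} _ = refl

𝟙-false : ∀ {b} → ¬ T b → 𝟙 b ≡ 0
𝟙-false {true}  ¬b = contradiction _ ¬b
𝟙-false {false} _  = refl

𝟙-not : ∀ b → 𝟙 (not b) + 𝟙 b ≡ 1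
𝟙-not true  = refl
𝟙-not false = refl

𝟙-split : ∀ a b → 𝟙 (a ∧ b) + 𝟙 (a ∧ not b) ≡ 𝟙 a
𝟙-split true  true  = refl
𝟙-split true  false = refl
𝟙-split false _     = refl

𝟙-∧ : ∀ a b → 𝟙 (a ∧ b) ≡ 𝟙 a * 𝟙 b
𝟙-∧ true  b = sym (+-identityʳ (𝟙 b))
𝟙-∧ false b = refl

-- The left operand is explicit because it cannot be recovered by unification from T (a ∧ b).
T-∧⁺ : ∀ a {b} → T a → T b → T (a ∧ b)
T-∧⁺ a ta tb = Equivalence.from T-∧ (ta , tb)

T-∧⁻ : ∀ a {b} → T (a ∧ b) → T a × T b
T-∧⁻ a = Equivalence.to T-∧

T-∨ʳ : ∀ a {b} → T b → T (a ∨ b)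
T-∨ʳ a tb = Equivalence.from T-∨ (inj₂ tb)

T-not⁺ : ∀ {b} → ¬ T b → T (not b)
T-not⁺ {true}  ¬b = ¬b _
T-not⁺ {false} _  = _

T-not⁻ : ∀ {b} → T (not b) → ¬ T b
T-not⁻ {true} ()

∧-congʳ-T : ∀ a {b c} → (T a → b ≡ c) → a ∧ b ≡ a ∧ c
∧-congʳ-T true  b≡c = b≡c _
∧-congʳ-T false _   = refl

eqBit-notˡ : ∀ x y → eqBit (not x) y ≡ not (eqBit x y)
eqBit-notˡ true  true  = refl
eqBit-notˡ true  false = refl
eqBit-notˡ false true  = refl
eqBit-notˡ false false = refl

eqBit-notʳ : ∀ x y → eqBit x (not y) ≡ not (eqBit x y)
eqBit-notʳ true  true  = refl
eqBit-notʳ true  false = refl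
eqBit-notʳ false true  = refl
eqBit-notʳ false false = refl

least-witness : ∀ (P : ℕ → Bool) {e} → T (P e) →
  ∃ λ d → d ≤ e × T (P d) × (∀ {k} → k < d → ¬ T (P k))
least-witness P {zero}  p₀ = 0 , z≤n , p₀ , λ ()
least-witness P {suc e} pₑ with T? (P 0)
... | yes p₀ = 0 , z≤n , p₀ , λ ()
... | no ¬p₀ with least-witness (P ∘ suc) pₑ
...   | d , d≤e , p-d , below =
  suc d , s≤s d≤e , p-d , λ { {zero} _ → ¬p₀ ; {suc k} (s<s k<d) → below k<d }

all-upTo-cong : ∀ n {p q : ℕ → Bool} → (∀ {k} → k < n → p k ≡ q k) → all p (upTo n) ≡ all q (upTo n)
all-upTo-cong n p≡q = cong and (map-cong-local (All.applyUpTo⁺₁ id n p≡q))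

T-all-upTo⁺ : ∀ (p : ℕ → Bool) n → (∀ {k} → k < n → T (p k)) → T (all p (upTo n))
T-all-upTo⁺ p n h = All.all⁻ p (All.applyUpTo⁺₁ id n h)

T-all-upTo⁻ : ∀ (p : ℕ → Bool) n → T (all p (upTo n)) → ∀ {k} → k < n → T (p k)
T-all-upTo⁻ p n h = All.applyUpTo⁻ id n (All.all⁺ p (upTo n) h)

T-any-upTo⁺ : ∀ (p : ℕ → Bool) n {k} → k < n → T (p k) → T (any p (upTo n))
T-any-upTo⁺ p n k<n pk = Any.any⁺ p (Any.applyUpTo⁺ id pk k<n)

length-filter-≟true : ∀ {A : Set} (P : A → Bool) xs →
  length (filter (λ x → P x ≟ᵇ true) xs) ≡ sum (map (𝟙 ∘ P) xs)
length-filter-≟true P []       = refl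
length-filter-≟true P (x ∷ xs) with P x
... | true  = cong suc (length-filter-≟true P xs)
... | false = length-filter-≟true P xs

Σ< : ℕ → (ℕ → ℕ) → ℕ
Σ< zero    f = 0
Σ< (suc n) f = f 0 + Σ< n (f ∘ suc)

sum-map-applyUpTo : ∀ (g : ℕ → ℕ) f n → sum (map g (applyUpTo f n)) ≡ Σ< n (g ∘ f)
sum-map-applyUpTo g f zero    = refl
sum-map-applyUpTo g f (suc n) = cong (g (f 0) +_) (sum-map-applyUpTo g (f ∘ suc) n)

Σ<-cong : ∀ n {f g : ℕ → ℕ} → (∀ {k} → k < n → f k ≡ g k) → Σ< n f ≡ Σ< n g
Σ<-cong zero    f≡g = refl
Σ<-cong (suc n) f≡g = cong₂ _+_ (f≡g z<s) (Σ<-cong n (f≡g ∘ s<s))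

Σ<-mono : ∀ n {f g : ℕ → ℕ} → (∀ {k} → k < n → f k ≤ g k) → Σ< n f ≤ Σ< n g
Σ<-mono zero    f≤g = z≤n
Σ<-mono (suc n) f≤g = +-mono-≤ (f≤g z<s) (Σ<-mono n (f≤g ∘ s<s))

Σ<-const : ∀ n c → Σ< n (λ _ → c) ≡ n * c
Σ<-const zero    c = refl
Σ<-const (suc n) c = cong (c +_) (Σ<-const n c)

Σ<-*ˡ : ∀ n c f → Σ< n (λ k → c * f k) ≡ c * Σ< n f
Σ<-*ˡ zero    c f = sym (*-zeroʳ c)
Σ<-*ˡ (suc n) c f = trans (cong (c * f 0 +_) (Σ<-*ˡ n c (f ∘ suc))) (sym (*-distribˡ-+ c (f 0) _))

Σ<-term : ∀ n f {k} → k < n → f k ≤ Σ< n f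
Σ<-term (suc n) f {zero}  _         = m≤m+n (f 0) _
Σ<-term (suc n) f {suc k} (s<s k<n) = ≤-trans (Σ<-term n (f ∘ suc) k<n) (m≤n+m _ (f 0))

Σ<-prefix : ∀ {a n} f → a ≤ n → Σ< a f ≤ Σ< n f
Σ<-prefix f z≤n       = z≤n
Σ<-prefix f (s≤s a≤n) = +-monoʳ-≤ (f 0) (Σ<-prefix (f ∘ suc) a≤n)

Σ<-tail : ∀ {a n} f → a < n → Σ< a (f ∘ suc) ≤ Σ< n f
Σ<-tail f (s≤s a≤n) = ≤-trans (Σ<-prefix (f ∘ suc) a≤n) (m≤n+m _ (f 0))

Σ<-𝟙-none : ∀ n (P : ℕ → Bool) → (∀ {k} → k < n → ¬ T (P k)) → Σ< n (𝟙 ∘ P) ≡ 0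
Σ<-𝟙-none zero    P none = refl
Σ<-𝟙-none (suc n) P none = cong₂ _+_ (𝟙-false (none z<s)) (Σ<-𝟙-none n (P ∘ suc) (none ∘ s<s))

Σ<-𝟙-≤ : ∀ n (P : ℕ → Bool) {b} →
  (∀ {j k} → j < k → k < n → T (P j) → T (P k) → ⊥) →
  (∀ {k} → k < n → T (P k) → T b) →
  Σ< n (𝟙 ∘ P) ≤ 𝟙 b
Σ<-𝟙-≤ zero    P exclusive implies = z≤n
Σ<-𝟙-≤ (suc n) P exclusive implies with T? (P 0)
... | yes p₀ rewrite 𝟙-true p₀ | 𝟙-true (implies z<s p₀)
                   | Σ<-𝟙-none n (P ∘ suc) (λ k<n → exclusive z<s (s<s k<n) p₀) = ≤-refl
... | no ¬p₀ rewrite 𝟙-false ¬p₀ =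
  Σ<-𝟙-≤ n (P ∘ suc) (λ j<k k<n → exclusive (s<s j<k) (s<s k<n)) (implies ∘ s<s)

-- Letters, flips and local agreement of strings

at-++ˡ : ∀ x y {k} → k < length x → at (x ++ y) k ≡ at x k
at-++ˡ (b ∷ x) y {zero}  _         = refl
at-++ˡ (b ∷ x) y {suc k} (s<s k<n) = at-++ˡ x y k<n

at-++ʳ : ∀ x y k → at (x ++ y) (length x + k) ≡ at y k
at-++ʳ []      y k = refl
at-++ʳ (b ∷ x) y k = at-++ʳ x y k

flipAt : ℕ → List Bool → List Bool
flipAt _       []      = []
flipAt zero    (b ∷ s) = not b ∷ s
flipAt (suc q) (b ∷ s) = b ∷ flipAt q s

length-flipAt : ∀ q s → length (flipAt q s) ≡ length s
length-flipAt _       []      = refl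
length-flipAt zero    (b ∷ s) = refl
length-flipAt (suc q) (b ∷ s) = cong suc (length-flipAt q s)

at-flipAt-≢ : ∀ q s {k} → k ≢ q → at (flipAt q s) k ≡ at s k
at-flipAt-≢ _       []      _         = refl
at-flipAt-≢ zero    (b ∷ s) {zero}  k≢q = contradiction refl k≢q
at-flipAt-≢ zero    (b ∷ s) {suc k} _   = refl
at-flipAt-≢ (suc q) (b ∷ s) {zero}  _   = refl
at-flipAt-≢ (suc q) (b ∷ s) {suc k} k≢q = at-flipAt-≢ q s (k≢q ∘ cong suc)

at-flipAt-≡ : ∀ q s → q < length s → at (flipAt q s) q ≡ not (at s q)
at-flipAt-≡ zero    (b ∷ s) _         = refl
at-flipAt-≡ (suc q) (b ∷ s) (s<s q<n) = at-flipAt-≡ q s q<n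

record AgreeOn (lo hi : ℕ) (s s′ : List Bool) : Set where
  constructor agreeOn
  field
    length-≡ : length s ≡ length s′
    at-≡     : ∀ {k} → lo ≤ k → k < hi → at s k ≡ at s′ k

AgreeOn-++ : ∀ x {z z′} → length z ≡ length z′ → AgreeOn 0 (length x) (x ++ z) (x ++ z′)
AgreeOn-++ x {z} {z′} ∣z∣≡ = agreeOn
  (trans (length-++ x) (trans (cong (length x +_) ∣z∣≡) (sym (length-++ x))))
  λ _ k<∣x∣ → trans (at-++ˡ x z k<∣x∣) (sym (at-++ˡ x z′ k<∣x∣))

AgreeOn-flipAt : ∀ {lo hi} q s → q < lo ⊎ hi ≤ q → AgreeOn lo hi (flipAt q s) s
AgreeOn-flipAt q s outside =
  agreeOn (length-flipAt q s) λ lo≤k k<hi → at-flipAt-≢ q s (k≢q outside lo≤k k<hi)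
  where
  k≢q : ∀ {lo hi k} → q < lo ⊎ hi ≤ q → lo ≤ k → k < hi → k ≢ q
  k≢q (inj₁ q<lo) lo≤k _    refl = <⇒≱ q<lo lo≤k
  k≢q (inj₂ hi≤q) _    k<hi refl = <⇒≱ k<hi hi≤q

occursAt-local : ∀ {lo hi s s′} i m p → AgreeOn lo hi s s′ →
  lo ≤ i → i + m ≤ hi → lo ≤ p → p + m ≤ hi → occursAt s i m p ≡ occursAt s′ i m p
occursAt-local {lo} {hi} {s} {s′} i m p (agreeOn ∣s∣≡ agree) lo≤i i+m≤hi lo≤p p+m≤hi =
  cong₂ _∧_ (cong (λ l → (p + m) <ᵇ suc l) ∣s∣≡)
            (all-upTo-cong m (λ k<m → cong₂ eqBit (agree-in i lo≤i i+m≤hi k<m) (agree-in p lo≤p p+m≤hi k<m)))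
  where
  agree-in : ∀ j {k} → lo ≤ j → j + m ≤ hi → k < m → at s (j + k) ≡ at s′ (j + k)
  agree-in j {k} lo≤j j+m≤hi k<m = agree (≤-trans lo≤j (m≤m+n j k)) (<-≤-trans (+-monoʳ-< j k<m) j+m≤hi)

Matches : ℕ → (ℕ → Bool) → List Bool → Bool
Matches m c B = all (λ k → eqBit (c k) (at B k)) (upTo m)

Matches-∷ : ∀ m c b B → Matches (suc m) c (b ∷ B) ≡ eqBit (c 0) b ∧ Matches m (c ∘ suc) B
Matches-∷ m c b B = cong (λ bs → eqBit (c 0) b ∧ and bs)
  (trans (map-applyUpTo suc (λ k → eqBit (c k) (at (b ∷ B) k)) m)
         (sym (map-applyUpTo id (λ k → eqBit (c (suc k)) (at B k)) m)))

occursAt-block : ∀ i m x B y → i + m ≤ length x → length B ≡ m →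
  occursAt (x ++ B ++ y) i m (length x) ≡ Matches m (λ k → at x (i + k)) B
occursAt-block i m x B y i+m≤∣x∣ ∣B∣≡m =
  cong₂ _∧_ (Equivalence.to T-≡ (<⇒<ᵇ (s≤s in-range)))
            (all-upTo-cong m (λ {k} k<m → cong₂ eqBit
              (at-++ˡ x (B ++ y) (<-≤-trans (+-monoʳ-< i k<m) i+m≤∣x∣))
              (trans (at-++ʳ x (B ++ y) k) (at-++ˡ B y (subst (k <_) (sym ∣B∣≡m) k<m)))))
  where
  open ≤-Reasoning
  in-range : length x + m ≤ length (x ++ B ++ y)
  in-range = begin
    length x + m                      ≤⟨ +-monoʳ-≤ (length x) (m≤m+n m (length y)) ⟩
    length x + (m + length y)         ≡⟨ cong (λ l → length x + (l + length y)) ∣B∣≡m ⟨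
    length x + (length B + length y)  ≡⟨ cong (length x +_) (length-++ B) ⟨
    length x + length (B ++ y)        ≡⟨ length-++ x ⟨
    length (x ++ B ++ y)              ∎

-- Sums over all binary strings of a given length

Σ𝔹 : ℕ → (List Bool → ℕ) → ℕ
Σ𝔹 n f = sum (map f (allStrings n))

#𝔹 : ℕ → (List Bool → Bool) → ℕ
#𝔹 n P = Σ𝔹 n (𝟙 ∘ P)

Σ𝔹-zero : ∀ f → Σ𝔹 0 f ≡ f []
Σ𝔹-zero f = +-identityʳ (f [])

Σ𝔹-suc : ∀ n f → Σ𝔹 (suc n) f ≡ Σ𝔹 n (f ∘ (false ∷_)) + Σ𝔹 n (f ∘ (true ∷_))
Σ𝔹-suc n f = go (allStrings n)
  where
  go : ∀ L → sum (map f (concatMap (λ s → (false ∷ s) ∷ (true ∷ s) ∷ []) L))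
           ≡ sum (map (f ∘ (false ∷_)) L) + sum (map (f ∘ (true ∷_)) L)
  go []      = refl
  go (s ∷ L) = trans (cong (λ x → f (false ∷ s) + (f (true ∷ s) + x)) (go L))
                     (trans (sym (+-assoc (f (false ∷ s)) _ _)) (interchange (f (false ∷ s)) (f (true ∷ s)) _ _))

Σ𝔹-cong : ∀ n {f g : List Bool → ℕ} → (∀ s → length s ≡ n → f s ≡ g s) → Σ𝔹 n f ≡ Σ𝔹 n g
Σ𝔹-cong zero            f≡g = cong (_+ 0) (f≡g [] refl)
Σ𝔹-cong (suc n) {f} {g} f≡g rewrite Σ𝔹-suc n f | Σ𝔹-suc n g =
  cong₂ _+_ (Σ𝔹-cong n (λ s ∣s∣ → f≡g (false ∷ s) (cong suc ∣s∣)))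
            (Σ𝔹-cong n (λ s ∣s∣ → f≡g (true ∷ s) (cong suc ∣s∣)))

Σ𝔹-mono : ∀ n {f g : List Bool → ℕ} → (∀ s → length s ≡ n → f s ≤ g s) → Σ𝔹 n f ≤ Σ𝔹 n g
Σ𝔹-mono zero            f≤g = +-monoˡ-≤ 0 (f≤g [] refl)
Σ𝔹-mono (suc n) {f} {g} f≤g rewrite Σ𝔹-suc n f | Σ𝔹-suc n g =
  +-mono-≤ (Σ𝔹-mono n (λ s ∣s∣ → f≤g (false ∷ s) (cong suc ∣s∣)))
           (Σ𝔹-mono n (λ s ∣s∣ → f≤g (true ∷ s) (cong suc ∣s∣)))

Σ𝔹-+ : ∀ n f g → Σ𝔹 n (λ s → f s + g s) ≡ Σ𝔹 n f + Σ𝔹 n g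
Σ𝔹-+ zero    f g = trans (Σ𝔹-zero (λ s → f s + g s)) (sym (cong₂ _+_ (Σ𝔹-zero f) (Σ𝔹-zero g)))
Σ𝔹-+ (suc n) f g rewrite Σ𝔹-suc n (λ s → f s + g s) | Σ𝔹-suc n f | Σ𝔹-suc n g =
  trans (cong₂ _+_ (Σ𝔹-+ n (f ∘ (false ∷_)) (g ∘ (false ∷_))) (Σ𝔹-+ n (f ∘ (true ∷_)) (g ∘ (true ∷_))))
        (interchange (Σ𝔹 n (f ∘ (false ∷_))) (Σ𝔹 n (g ∘ (false ∷_)))
                     (Σ𝔹 n (f ∘ (true ∷_)))  (Σ𝔹 n (g ∘ (true ∷_))))

Σ𝔹-*ˡ : ∀ n c f → Σ𝔹 n (λ s → c * f s) ≡ c * Σ𝔹 n f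
Σ𝔹-*ˡ zero    c f = trans (Σ𝔹-zero (λ s → c * f s)) (cong (c *_) (sym (Σ𝔹-zero f)))
Σ𝔹-*ˡ (suc n) c f rewrite Σ𝔹-suc n (λ s → c * f s) | Σ𝔹-suc n f =
  trans (cong₂ _+_ (Σ𝔹-*ˡ n c (f ∘ (false ∷_))) (Σ𝔹-*ˡ n c (f ∘ (true ∷_)))) (sym (*-distribˡ-+ c _ _))

Σ𝔹-const : ∀ n c → Σ𝔹 n (λ _ → c) ≡ 2 ^ n * c
Σ𝔹-const zero    c = trans (Σ𝔹-zero (λ _ → c)) (sym (*-identityˡ c))
Σ𝔹-const (suc n) c = begin
  Σ𝔹 (suc n) (λ _ → c)             ≡⟨ Σ𝔹-suc n (λ _ → c) ⟩
  Σ𝔹 n (λ _ → c) + Σ𝔹 n (λ _ → c)  ≡⟨ cong₂ _+_ (Σ𝔹-const n c) (Σ𝔹-const n c) ⟩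
  2 ^ n * c + 2 ^ n * c            ≡⟨ cong (2 ^ n * c +_) (+-identityʳ (2 ^ n * c)) ⟨
  2 * (2 ^ n * c)                  ≡⟨ *-assoc 2 (2 ^ n) c ⟨
  2 ^ suc n * c                    ∎
  where open ≡-Reasoning

Σ𝔹-0 : ∀ n → Σ𝔹 n (λ _ → 0) ≡ 0
Σ𝔹-0 n = trans (Σ𝔹-const n 0) (*-zeroʳ (2 ^ n))

Σ𝔹-++ : ∀ a b f → Σ𝔹 (a + b) f ≡ Σ𝔹 a (λ x → Σ𝔹 b (λ y → f (x ++ y)))
Σ𝔹-++ zero    b f = sym (Σ𝔹-zero (λ x → Σ𝔹 b (λ y → f (x ++ y))))
Σ𝔹-++ (suc a) b f rewrite Σ𝔹-suc (a + b) f | Σ𝔹-suc a (λ x → Σ𝔹 b (λ y → f (x ++ y))) =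
  cong₂ _+_ (Σ𝔹-++ a b (f ∘ (false ∷_))) (Σ𝔹-++ a b (f ∘ (true ∷_)))

Σ𝔹-prefix : ∀ K r {f : List Bool → ℕ} (g : List Bool → ℕ) →
  (∀ x z → length x ≡ K → length z ≡ r → f (x ++ z) ≡ g x) → Σ𝔹 (K + r) f ≡ 2 ^ r * Σ𝔹 K g
Σ𝔹-prefix K r g f≡g =
  trans (Σ𝔹-++ K r _)
  (trans (Σ𝔹-cong K (λ x ∣x∣ → trans (Σ𝔹-cong r (λ z ∣z∣ → f≡g x z ∣x∣ ∣z∣)) (Σ𝔹-const r (g x))))
         (Σ𝔹-*ˡ K (2 ^ r) g))

Σ𝔹-Σ< : ∀ n K (g : List Bool → ℕ → ℕ) → Σ𝔹 n (λ s → Σ< K (g s)) ≡ Σ< K (λ k → Σ𝔹 n (λ s → g s k))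
Σ𝔹-Σ< n zero    g = Σ𝔹-0 n
Σ𝔹-Σ< n (suc K) g = trans (Σ𝔹-+ n (λ s → g s 0) (λ s → Σ< K (g s ∘ suc)))
                          (cong (Σ𝔹 n (λ s → g s 0) +_) (Σ𝔹-Σ< n K (λ s → g s ∘ suc)))

Σ𝔹-flipAt : ∀ n q f → Σ𝔹 n (f ∘ flipAt q) ≡ Σ𝔹 n f
Σ𝔹-flipAt zero    q       f = refl
Σ𝔹-flipAt (suc n) zero    f rewrite Σ𝔹-suc n (f ∘ flipAt zero) | Σ𝔹-suc n f =
  +-comm (Σ𝔹 n (f ∘ (true ∷_))) (Σ𝔹 n (f ∘ (false ∷_)))
Σ𝔹-flipAt (suc n) (suc q) f rewrite Σ𝔹-suc n (f ∘ flipAt (suc q)) | Σ𝔹-suc n f =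
  cong₂ _+_ (Σ𝔹-flipAt n q (f ∘ (false ∷_))) (Σ𝔹-flipAt n q (f ∘ (true ∷_)))

#𝔹-halve : ∀ n q (G R : List Bool → Bool) →
  (∀ s → length s ≡ n → G (flipAt q s) ≡ G s) →
  (∀ s → length s ≡ n → R (flipAt q s) ≡ not (R s)) →
  2 * #𝔹 n (λ s → G s ∧ R s) ≡ #𝔹 n G
#𝔹-halve n q G R G∘flip R∘flip = begin
  2 * #G∧R
    ≡⟨ cong (#G∧R +_) (+-identityʳ #G∧R) ⟩
  #G∧R + #G∧R
    ≡⟨ cong (#G∧R +_) flip-swaps ⟩
  #G∧R + #𝔹 n (λ s → G s ∧ not (R s))
    ≡⟨ Σ𝔹-+ n (λ s → 𝟙 (G s ∧ R s)) (λ s → 𝟙 (G s ∧ not (R s))) ⟨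
  Σ𝔹 n (λ s → 𝟙 (G s ∧ R s) + 𝟙 (G s ∧ not (R s)))
    ≡⟨ Σ𝔹-cong n (λ s _ → 𝟙-split (G s) (R s)) ⟩
  #𝔹 n G ∎
  where
  open ≡-Reasoning
  #G∧R = #𝔹 n (λ s → G s ∧ R s)
  flip-swaps : #G∧R ≡ #𝔹 n (λ s → G s ∧ not (R s))
  flip-swaps = trans (sym (Σ𝔹-flipAt n q (λ s → 𝟙 (G s ∧ R s))))
                     (Σ𝔹-cong n (λ s ∣s∣ → cong₂ (λ x y → 𝟙 (x ∧ y)) (G∘flip s ∣s∣) (R∘flip s ∣s∣)))

#𝔹-not : ∀ n P → #𝔹 n (not ∘ P) + #𝔹 n P ≡ 2 ^ n
#𝔹-not n P = begin
  #𝔹 n (not ∘ P) + #𝔹 n P               ≡⟨ Σ𝔹-+ n (𝟙 ∘ not ∘ P) (𝟙 ∘ P) ⟨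
  Σ𝔹 n (λ s → 𝟙 (not (P s)) + 𝟙 (P s))  ≡⟨ Σ𝔹-cong n (λ s _ → 𝟙-not (P s)) ⟩
  Σ𝔹 n (λ _ → 1)                        ≡⟨ Σ𝔹-const n 1 ⟩
  2 ^ n * 1                             ≡⟨ *-identityʳ (2 ^ n) ⟩
  2 ^ n                                 ∎
  where open ≡-Reasoning

#𝔹-Matches : ∀ m c → #𝔹 m (Matches m c) ≡ 1
#𝔹-Matches zero    c = refl
#𝔹-Matches (suc m) c = begin
  #𝔹 (suc m) (Matches (suc m) c)
    ≡⟨ Σ𝔹-suc m (𝟙 ∘ Matches (suc m) c) ⟩
  Σ𝔹 m (λ B → 𝟙 (Matches (suc m) c (false ∷ B))) + Σ𝔹 m (λ B → 𝟙 (Matches (suc m) c (true ∷ B)))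
    ≡⟨ cong₂ _+_ (Σ𝔹-cong m (λ B _ → cong 𝟙 (Matches-∷ m c false B)))
                 (Σ𝔹-cong m (λ B _ → cong 𝟙 (Matches-∷ m c true B))) ⟩
  #𝔹 m (λ B → eqBit (c 0) false ∧ M B) + #𝔹 m (λ B → eqBit (c 0) true ∧ M B)
    ≡⟨ one-head-matches (c 0) ⟩
  #𝔹 m M
    ≡⟨ #𝔹-Matches m (c ∘ suc) ⟩
  1 ∎
  where
  open ≡-Reasoning
  M = Matches m (c ∘ suc)
  one-head-matches : ∀ x → #𝔹 m (λ B → eqBit x false ∧ M B) + #𝔹 m (λ B → eqBit x true ∧ M B) ≡ #𝔹 m M
  one-head-matches true  = cong (_+ #𝔹 m M) (Σ𝔹-0 m)
  one-head-matches false = trans (cong (#𝔹 m M +_) (Σ𝔹-0 m)) (+-identityʳ (#𝔹 m M))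

#𝔹-mismatch : ∀ m c → #𝔹 m (not ∘ Matches m c) ≡ 2 ^ m ∸ 1
#𝔹-mismatch m c = begin
  #¬M                          ≡⟨ m+n∸n≡m #¬M 1 ⟨
  #¬M + 1 ∸ 1                  ≡⟨ cong (λ k → #¬M + k ∸ 1) (#𝔹-Matches m c) ⟨
  #¬M + #𝔹 m (Matches m c) ∸ 1  ≡⟨ cong (_∸ 1) (#𝔹-not m (Matches m c)) ⟩
  2 ^ m ∸ 1                    ∎
  where
  open ≡-Reasoning
  #¬M = #𝔹 m (not ∘ Matches m c)

binomial-two-terms : ∀ c k → c ^ suc k + suc k * c ^ k ≤ suc c ^ suc k
binomial-two-terms c zero    = ≤-reflexive (base c)
  where
  base : ∀ c → c * 1 + 1 * 1 ≡ (1 + c) * 1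
  base = solve-∀
binomial-two-terms c (suc k) = begin
  c ^ suc (suc k) + suc (suc k) * c ^ suc k                  ≤⟨ m≤m+n _ (suc k * c ^ k) ⟩
  c ^ suc (suc k) + suc (suc k) * c ^ suc k + suc k * c ^ k  ≡⟨ factor c k (c ^ k) ⟩
  suc c * (c ^ suc k + suc k * c ^ k)                        ≤⟨ *-monoʳ-≤ (suc c) (binomial-two-terms c k) ⟩
  suc c ^ suc (suc k)                                        ∎
  where
  open ≤-Reasoning
  factor : ∀ c k x → c * (c * x) + (2 + k) * (c * x) + (1 + k) * x ≡ (1 + c) * (c * x + (1 + k) * x)
  factor = solve-∀

2*c^[1+c]≤[1+c]^[1+c] : ∀ c → 2 * c ^ suc c ≤ suc c ^ suc c
2*c^[1+c]≤[1+c]^[1+c] c = begin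
  2 * c ^ suc c              ≡⟨ cong (c ^ suc c +_) (+-identityʳ (c ^ suc c)) ⟩
  c ^ suc c + c ^ suc c      ≤⟨ +-monoʳ-≤ (c ^ suc c) (*-monoˡ-≤ (c ^ c) (n≤1+n c)) ⟩
  c ^ suc c + suc c * c ^ c  ≤⟨ binomial-two-terms c c ⟩
  suc c ^ suc c              ∎
  where open ≤-Reasoning

-- (1 - 1/(c+1))^(c+1) ≤ 1/2, with the denominators cleared.
2*≤-from-ratio : ∀ c x N → x * suc c ^ suc c ≡ N * c ^ suc c → 2 * x ≤ N
2*≤-from-ratio c x N ratio = *-cancelʳ-≤ (2 * x) N (suc c ^ suc c) {{m^n≢0 (suc c) (suc c)}} (begin
  2 * x * suc c ^ suc c    ≡⟨ *-assoc 2 x _ ⟩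
  2 * (x * suc c ^ suc c)  ≡⟨ cong (2 *_) ratio ⟩
  2 * (N * c ^ suc c)      ≡⟨ x∙yz≈y∙xz 2 N _ ⟩
  N * (2 * c ^ suc c)      ≤⟨ *-monoʳ-≤ N (2*c^[1+c]≤[1+c]^[1+c] c) ⟩
  N * suc c ^ suc c        ∎)
  where open ≤-Reasoning

n<2^n : ∀ n → n < 2 ^ n
n<2^n zero    = z<s
n<2^n (suc n) = begin-strict
  suc n          ≤⟨ n<2^n n ⟩
  2 ^ n          <⟨ m<m+n (2 ^ n) (m^n>0 2 n) ⟩
  2 ^ n + 2 ^ n  ≡⟨ cong (2 ^ n +_) (+-identityʳ (2 ^ n)) ⟨
  2 ^ suc n      ∎
  where open ≤-Reasoning

m+2^m*m<2^m*2^m : ∀ m → m + 2 ^ m * m < 2 ^ m * 2 ^ m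
m+2^m*m<2^m*2^m m = begin-strict
  m + 2 ^ m * m      <⟨ +-monoˡ-< (2 ^ m * m) (n<2^n m) ⟩
  2 ^ m + 2 ^ m * m  ≡⟨ *-suc (2 ^ m) m ⟨
  2 ^ m * suc m      ≤⟨ *-monoʳ-≤ (2 ^ m) (n<2^n m) ⟩
  2 ^ m * 2 ^ m      ∎
  where open ≤-Reasoning

2*m≤n⇒m<n : ∀ {m n} → 2 * m ≤ n → 0 < n → m < n
2*m≤n⇒m<n {zero}  _    0<n = 0<n
2*m≤n⇒m<n {suc m} 2m≤n _   = <-≤-trans (m<m+n (suc m) z<s) 2m≤n

m≤2*[m/n]*n : ∀ m n .{{_ : NonZero n}} → n ≤ m → m ≤ 2 * (m / n) * n
m≤2*[m/n]*n m n n≤m = begin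
  m                      ≡⟨ m≡m%n+[m/n]*n m n ⟩
  m % n + m / n * n      ≤⟨ +-monoˡ-≤ (m / n * n) (<⇒≤ (m%n<n m n)) ⟩
  n + m / n * n          ≤⟨ +-monoˡ-≤ (m / n * n) n≤[m/n]*n ⟩
  m / n * n + m / n * n  ≡⟨ cong (m / n * n +_) (+-identityʳ (m / n * n)) ⟨
  2 * (m / n * n)        ≡⟨ *-assoc 2 (m / n) n ⟨
  2 * (m / n) * n        ∎
  where
  open ≤-Reasoning
  n≤[m/n]*n : n ≤ m / n * n
  n≤[m/n]*n = ≤-trans (≤-reflexive (sym (*-identityˡ n))) (*-monoˡ-≤ n (m≥n⇒m/n>0 n≤m))

2+2m≤4m : ∀ m → 1 ≤ m → 2 + (m + m) ≤ m * 4
2+2m≤4m m 1≤m = begin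
  2 + (m + m)      ≤⟨ +-monoˡ-≤ (m + m) (+-mono-≤ 1≤m 1≤m) ⟩
  m + m + (m + m)  ≡⟨ four m ⟩
  m * 4            ∎
  where
  open ≤-Reasoning
  four : ∀ m → m + m + (m + m) ≡ m * 4
  four = solve-∀

≤⌈log₂⌉ : ∀ {t n} → 2 ^ t ≤ n → t ≤ ⌈log₂ n ⌉
≤⌈log₂⌉ {t} {n} 2^t≤n = subst (_≤ ⌈log₂ n ⌉) (⌈log₂2^n⌉≡n t) (⌈log₂⌉-mono-≤ 2^t≤n)

<⌈log₂⌉⇒2^<n : ∀ {t n} → t < ⌈log₂ n ⌉ → 2 ^ t < n
<⌈log₂⌉⇒2^<n {t} {n} t<log = ≰⇒> λ n≤2^t →
  <⇒≱ t<log (subst (⌈log₂ n ⌉ ≤_) (⌈log₂2^n⌉≡n t) (⌈log₂⌉-mono-≤ n≤2^t))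

-- A fixed candidate s[i .. i+m-1]

module Repeat (i m : ℕ) where

  OccBetween : ℕ → List Bool → ℕ → Bool
  OccBetween i′ s p = (i <ᵇ p) ∧ (p <ᵇ i′) ∧ occursAt s i m p

  NextOcc : ℕ → List Bool → Bool
  NextOcc i′ s = occursAt s i m i′ ∧ all (not ∘ OccBetween i′ s) (upTo (length s))

  LeftMaximal : ℕ → List Bool → Bool
  LeftMaximal i′ s = not (eqBit (at s (i ∸ 1)) (at s (i′ ∸ 1)))

  RightMaximal : ℕ → List Bool → Bool
  RightMaximal i′ s = not (eqBit (at s (i + m)) (at s (i′ + m)))

  ClosedAt : ℕ → List Bool → Bool
  ClosedAt i′ s = (NextOcc i′ s ∧ LeftMaximal i′ s) ∧ RightMaximal i′ s

  occursAt-bound : ∀ s {p} → T (occursAt s i m p) → p + m ≤ length s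
  occursAt-bound s {p} occ =
    ≤-pred (<ᵇ⇒< (p + m) (suc (length s)) (proj₁ (T-∧⁻ (p + m <ᵇ suc (length s)) occ)))

  NextOcc-local : ∀ i′ {s s′} → i ≤ i′ → AgreeOn i (i′ + m) s s′ → NextOcc i′ s ≡ NextOcc i′ s′
  NextOcc-local i′ {s} {s′} i≤i′ agree@(agreeOn ∣s∣≡ _) =
    cong₂ _∧_ (occursAt-local i m i′ agree ≤-refl (+-monoˡ-≤ m i≤i′) i≤i′ ≤-refl)
              (trans (all-upTo-cong (length s) (λ {p} _ → cong not (between-≡ p)))
                     (cong (λ l → all (not ∘ OccBetween i′ s′) (upTo l)) ∣s∣≡))
    where
    between-≡ : ∀ p → OccBetween i′ s p ≡ OccBetween i′ s′ p
    between-≡ p = ∧-congʳ-T (i <ᵇ p) λ i<p → ∧-congʳ-T (p <ᵇ i′) λ p<i′ →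
      occursAt-local i m p agree ≤-refl (+-monoˡ-≤ m i≤i′)
                     (<⇒≤ (<ᵇ⇒< i p i<p)) (+-monoˡ-≤ m (<⇒≤ (<ᵇ⇒< p i′ p<i′)))

  NextOcc-exclusive : ∀ s {i′ i″} → 1 ≤ m → i < i′ → i′ < i″ →
    T (NextOcc i′ s) → T (NextOcc i″ s) → ⊥
  NextOcc-exclusive s {i′} {i″} 1≤m i<i′ i′<i″ next′ next″ =
    T-not⁻ (T-all-upTo⁻ _ (length s) (proj₂ (T-∧⁻ (occursAt s i m i″) next″)) i′<∣s∣)
           (T-∧⁺ (i <ᵇ i′) (<⇒<ᵇ i<i′) (T-∧⁺ (i′ <ᵇ i″) (<⇒<ᵇ i′<i″) occ′))
    where
    occ′ = proj₁ (T-∧⁻ (occursAt s i m i′) next′)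
    i′<∣s∣ = <-≤-trans (m<m+n i′ 1≤m) (occursAt-bound s occ′)

  NextOcc-exists : ∀ s {e} → i < e → T (occursAt s i m e) →
    ∃ λ i′ → i < i′ × i′ ≤ e × T (NextOcc i′ s)
  NextOcc-exists s {e} i<e occ
    with least-witness (λ p → (i <ᵇ p) ∧ occursAt s i m p) (T-∧⁺ (i <ᵇ e) (<⇒<ᵇ i<e) occ)
  ... | i′ , i′≤e , first , none-before =
    let i<i′ , occ′ = T-∧⁻ (i <ᵇ i′) first in
    i′ , <ᵇ⇒< i i′ i<i′ , i′≤e ,
    T-∧⁺ (occursAt s i m i′) occ′ (T-all-upTo⁺ _ (length s) λ {p} _ → T-not⁺ λ between →
      let i<p , p<i′∧occ = T-∧⁻ (i <ᵇ p) between
          p<i′ , occ-p   = T-∧⁻ (p <ᵇ i′) p<i′∧occ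
      in none-before (<ᵇ⇒< p i′ p<i′) (T-∧⁺ (i <ᵇ p) i<p occ-p))

  ClosedAt⇒isClosedRepeat : ∀ s {i′} → 1 ≤ m → i < i′ → i′ + m < length s →
    T (ClosedAt i′ s) → T (isClosedRepeat s i m)
  ClosedAt⇒isClosedRepeat s {i′} 1≤m i<i′ i′+m<∣s∣ closed =
    let next∧left , right  = T-∧⁻ (NextOcc i′ s ∧ LeftMaximal i′ s) closed
        next , left        = T-∧⁻ (NextOcc i′ s) next∧left
        occ , none-between = T-∧⁻ (occursAt s i m i′) next
    in T-∧⁺ (not (m ≡ᵇ 0)) (T-not⁺ (λ m≡ᵇ0 → <⇒≢ 1≤m (sym (≡ᵇ⇒≡ m 0 m≡ᵇ0))))
      (T-∧⁺ (i + m <ᵇ suc (length s)) (<⇒<ᵇ (s≤s (≤-trans (+-monoˡ-≤ m (<⇒≤ i<i′)) (<⇒≤ i′+m<∣s∣))))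
        (T-any-upTo⁺ _ (length s) (≤-<-trans (m≤m+n i′ m) i′+m<∣s∣)
          (T-∧⁺ (i <ᵇ i′) (<⇒<ᵇ i<i′)
            (T-∧⁺ (occursAt s i m i′) occ
              (T-∧⁺ (all (not ∘ OccBetween i′ s) (upTo (length s))) none-between
                (T-∧⁺ ((i′ + m ≡ᵇ length s) ∨ RightMaximal i′ s) (T-∨ʳ (i′ + m ≡ᵇ length s) right)
                      (T-∨ʳ (i ≡ᵇ 0) left)))))))

  NextOcc-flipAt : ∀ s {i′ q} → i < i′ → q < i ⊎ i′ + m ≤ q → NextOcc i′ (flipAt q s) ≡ NextOcc i′ s
  NextOcc-flipAt s {i′} {q} i<i′ outside = NextOcc-local i′ (<⇒≤ i<i′) (AgreeOn-flipAt q s outside)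

  LeftMaximal-flipAt-after : ∀ s {i′} → 1 ≤ m → i < i′ →
    LeftMaximal i′ (flipAt (i′ + m) s) ≡ LeftMaximal i′ s
  LeftMaximal-flipAt-after s {i′} 1≤m i<i′ = cong₂ (λ x y → not (eqBit x y))
    (at-flipAt-≢ (i′ + m) s (<⇒≢ (≤-<-trans (m∸n≤m i 1) (<-≤-trans i<i′ (m≤m+n i′ m)))))
    (at-flipAt-≢ (i′ + m) s (<⇒≢ (≤-<-trans (m∸n≤m i′ 1) (m<m+n i′ 1≤m))))

  LeftMaximal-flipAt-before : ∀ s {i′} → 1 ≤ i → i < i′ → i ∸ 1 < length s →
    LeftMaximal i′ (flipAt (i ∸ 1) s) ≡ not (LeftMaximal i′ s)
  LeftMaximal-flipAt-before s {i′} 1≤i i<i′ i∸1<∣s∣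
    rewrite at-flipAt-≡ (i ∸ 1) s i∸1<∣s∣ | at-flipAt-≢ (i ∸ 1) s (>⇒≢ (∸-monoˡ-< i<i′ 1≤i)) =
    cong not (eqBit-notˡ (at s (i ∸ 1)) (at s (i′ ∸ 1)))

  RightMaximal-flipAt-after : ∀ s {i′} → i < i′ → i′ + m < length s →
    RightMaximal i′ (flipAt (i′ + m) s) ≡ not (RightMaximal i′ s)
  RightMaximal-flipAt-after s {i′} i<i′ i′+m<∣s∣
    rewrite at-flipAt-≡ (i′ + m) s i′+m<∣s∣ | at-flipAt-≢ (i′ + m) s (<⇒≢ (+-monoˡ-< m i<i′)) =
    cong not (eqBit-notʳ (at s (i + m)) (at s (i′ + m)))

  4*#ClosedAt≡#NextOcc : ∀ n {i′} → 1 ≤ i → 1 ≤ m → i < i′ → i′ + m < n →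
    4 * #𝔹 n (ClosedAt i′) ≡ #𝔹 n (NextOcc i′)
  4*#ClosedAt≡#NextOcc n {i′} 1≤i 1≤m i<i′ i′+m<n = begin
    4 * #𝔹 n (ClosedAt i′)
      ≡⟨ *-assoc 2 2 (#𝔹 n (ClosedAt i′)) ⟩
    2 * (2 * #𝔹 n (ClosedAt i′))
      ≡⟨ cong (2 *_) (#𝔹-halve n (i′ + m) _ (RightMaximal i′) next∧left-fixed right-flips) ⟩
    2 * #𝔹 n (λ s → NextOcc i′ s ∧ LeftMaximal i′ s)
      ≡⟨ #𝔹-halve n (i ∸ 1) (NextOcc i′) (LeftMaximal i′) next-fixed left-flips ⟩
    #𝔹 n (NextOcc i′) ∎
    where
    open ≡-Reasoning
    i∸1<n : i ∸ 1 < n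
    i∸1<n = ≤-<-trans (m∸n≤m i 1) (<-trans i<i′ (≤-<-trans (m≤m+n i′ m) i′+m<n))
    next∧left-fixed : ∀ s → length s ≡ n → _
    next∧left-fixed s _ =
      cong₂ _∧_ (NextOcc-flipAt s i<i′ (inj₂ ≤-refl)) (LeftMaximal-flipAt-after s 1≤m i<i′)
    right-flips : ∀ s → length s ≡ n → _
    right-flips s refl = RightMaximal-flipAt-after s i<i′ i′+m<n
    next-fixed : ∀ s → length s ≡ n → _
    next-fixed s _ = NextOcc-flipAt s i<i′ (inj₁ (∸-monoˡ-< (n<1+n i) 1≤i))
    left-flips : ∀ s → length s ≡ n → _
    left-flips s refl = LeftMaximal-flipAt-before s 1≤i i<i′ i∸1<n

  Avoid : ℕ → List Bool → Bool
  Avoid zero    s = true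
  Avoid (suc J) s = Avoid J s ∧ not (occursAt s i m (i + suc J * m))

  i+[1+J]*m+m≡i+[2+J]*m : ∀ J → i + suc J * m + m ≡ i + suc (suc J) * m
  i+[1+J]*m+m≡i+[2+J]*m J = trans (+-assoc i (suc J * m) m) (cong (i +_) (+-comm (suc J * m) m))

  Avoid-local : ∀ J {hi s s′} → i + suc J * m ≤ hi → AgreeOn 0 hi s s′ → Avoid J s ≡ Avoid J s′
  Avoid-local zero    _     _     = refl
  Avoid-local (suc J) bound agree =
    cong₂ _∧_ (Avoid-local J K≤hi agree)
              (cong not (occursAt-local i m _ agree z≤n i+m≤hi z≤n K+m≤hi))
    where
    K+m≤hi = ≤-trans (≤-reflexive (i+[1+J]*m+m≡i+[2+J]*m J)) bound
    K≤hi   = ≤-trans (m≤m+n _ m) K+m≤hi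
    i+m≤hi = ≤-trans (+-monoʳ-≤ i (m≤m+n m _)) K≤hi

  #Avoid-step : ∀ J n → i + suc (suc J) * m ≤ n →
    #𝔹 n (Avoid (suc J)) * 2 ^ m ≡ (2 ^ m ∸ 1) * #𝔹 n (Avoid J)
  #Avoid-step J n bound with m≤n⇒∃[o]m+o≡n (≤-trans (≤-reflexive (i+[1+J]*m+m≡i+[2+J]*m J)) bound)
  ... | r , refl rewrite +-assoc (i + suc J * m) m r = begin
    #𝔹 (K + (m + r)) (Avoid (suc J)) * 2 ^ m  ≡⟨ cong (_* 2 ^ m) #Avoid-sucJ ⟩
    2 ^ r * c * G * 2 ^ m                    ≡⟨ rearrange (2 ^ m) (2 ^ r) c G ⟩
    c * (2 ^ m * 2 ^ r * G)                  ≡⟨ cong (λ t → c * (t * G)) (^-distribˡ-+-* 2 m r) ⟨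
    c * (2 ^ (m + r) * G)                    ≡⟨ cong (c *_) #Avoid-J ⟨
    c * #𝔹 (K + (m + r)) (Avoid J)            ∎
    where
    open ≡-Reasoning
    K  = i + suc J * m
    c  = 2 ^ m ∸ 1
    z₀ = replicate (m + r) false
    G  = Σ𝔹 K (λ x → 𝟙 (Avoid J (x ++ z₀)))

    rearrange : ∀ a b c g → b * c * g * a ≡ c * (a * b * g)
    rearrange = solve-∀

    prefix-only : ∀ x z → length x ≡ K → length z ≡ m + r → Avoid J (x ++ z) ≡ Avoid J (x ++ z₀)
    prefix-only x z ∣x∣ ∣z∣ =
      Avoid-local J (≤-reflexive (sym ∣x∣)) (AgreeOn-++ x (trans ∣z∣ (sym (length-replicate (m + r)))))

    #Avoid-J : #𝔹 (K + (m + r)) (Avoid J) ≡ 2 ^ (m + r) * G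
    #Avoid-J = Σ𝔹-prefix K (m + r) _ (λ x z ∣x∣ ∣z∣ → cong 𝟙 (prefix-only x z ∣x∣ ∣z∣))

    mismatches : ∀ x → length x ≡ K → Σ𝔹 (m + r) (λ z → 𝟙 (not (occursAt (x ++ z) i m K))) ≡ 2 ^ r * c
    mismatches x ∣x∣ = begin
      Σ𝔹 (m + r) (λ z → 𝟙 (not (occursAt (x ++ z) i m K)))
        ≡⟨ Σ𝔹-prefix m r (𝟙 ∘ not ∘ Matches m target)
                     (λ B y ∣B∣ _ → cong (𝟙 ∘ not) (block B y ∣B∣)) ⟩
      2 ^ r * #𝔹 m (not ∘ Matches m target)
        ≡⟨ cong (2 ^ r *_) (#𝔹-mismatch m target) ⟩
      2 ^ r * c ∎
      where
      target = λ k → at x (i + k)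
      block : ∀ B y → length B ≡ m → occursAt (x ++ B ++ y) i m K ≡ Matches m target B
      block B y ∣B∣ = subst (λ p → occursAt (x ++ B ++ y) i m p ≡ Matches m target B) ∣x∣
        (occursAt-block i m x B y (≤-trans (+-monoʳ-≤ i (m≤m+n m _)) (≤-reflexive (sym ∣x∣))) ∣B∣)

    #Avoid-sucJ : #𝔹 (K + (m + r)) (Avoid (suc J)) ≡ 2 ^ r * c * G
    #Avoid-sucJ = trans (Σ𝔹-++ K (m + r) _) (trans (Σ𝔹-cong K inner) (Σ𝔹-*ˡ K (2 ^ r * c) _))
      where
      inner : ∀ x → length x ≡ K →
        Σ𝔹 (m + r) (λ z → 𝟙 (Avoid (suc J) (x ++ z))) ≡ 2 ^ r * c * 𝟙 (Avoid J (x ++ z₀))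
      inner x ∣x∣ = begin
        Σ𝔹 (m + r) (λ z → 𝟙 (Avoid (suc J) (x ++ z)))
          ≡⟨ Σ𝔹-cong (m + r) (λ z ∣z∣ → trans (𝟙-∧ (Avoid J (x ++ z)) _)
                                               (cong (λ b → 𝟙 b * _) (prefix-only x z ∣x∣ ∣z∣))) ⟩
        Σ𝔹 (m + r) (λ z → a * 𝟙 (not (occursAt (x ++ z) i m K)))
          ≡⟨ Σ𝔹-*ˡ (m + r) a _ ⟩
        a * Σ𝔹 (m + r) (λ z → 𝟙 (not (occursAt (x ++ z) i m K)))
          ≡⟨ cong (a *_) (mismatches x ∣x∣) ⟩
        a * (2 ^ r * c)
          ≡⟨ *-comm a (2 ^ r * c) ⟩
        2 ^ r * c * a ∎
        where a = 𝟙 (Avoid J (x ++ z₀))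

  #Avoid-formula : ∀ J n → i + suc J * m ≤ n → #𝔹 n (Avoid J) * (2 ^ m) ^ J ≡ 2 ^ n * (2 ^ m ∸ 1) ^ J
  #Avoid-formula zero    n _     = trans (*-identityʳ _) (Σ𝔹-const n 1)
  #Avoid-formula (suc J) n bound = begin
    #𝔹 n (Avoid (suc J)) * (2 ^ m * (2 ^ m) ^ J)  ≡⟨ *-assoc (#𝔹 n (Avoid (suc J))) (2 ^ m) _ ⟨
    #𝔹 n (Avoid (suc J)) * 2 ^ m * (2 ^ m) ^ J    ≡⟨ cong (_* (2 ^ m) ^ J) (#Avoid-step J n bound) ⟩
    c * #𝔹 n (Avoid J) * (2 ^ m) ^ J              ≡⟨ *-assoc c (#𝔹 n (Avoid J)) ((2 ^ m) ^ J) ⟩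
    c * (#𝔹 n (Avoid J) * (2 ^ m) ^ J)            ≡⟨ cong (c *_) (#Avoid-formula J n J-bound) ⟩
    c * (2 ^ n * c ^ J)                           ≡⟨ x∙yz≈y∙xz c (2 ^ n) (c ^ J) ⟩
    2 ^ n * (c * c ^ J)                           ∎
    where
    open ≡-Reasoning
    c = 2 ^ m ∸ 1
    J-bound = ≤-trans (m≤m+n _ m) (≤-trans (≤-reflexive (i+[1+J]*m+m≡i+[2+J]*m J)) bound)

  2^n≤2*#¬Avoid : ∀ n → i + suc (2 ^ m) * m ≤ n → 2 ^ n ≤ 2 * #𝔹 n (not ∘ Avoid (2 ^ m))
  2^n≤2*#¬Avoid n bound = +-cancelʳ-≤ (2 ^ n) (2 ^ n) (2 * #¬A) (begin
    2 ^ n + 2 ^ n     ≡⟨ cong (2 ^ n +_) (+-identityʳ (2 ^ n)) ⟨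
    2 * 2 ^ n         ≡⟨ cong (2 *_) (#𝔹-not n (Avoid (2 ^ m))) ⟨
    2 * (#¬A + #A)    ≡⟨ *-distribˡ-+ 2 #¬A #A ⟩
    2 * #¬A + 2 * #A  ≤⟨ +-monoʳ-≤ (2 * #¬A) (2*≤-from-ratio c #A (2 ^ n) ratio) ⟩
    2 * #¬A + 2 ^ n   ∎)
    where
    open ≤-Reasoning
    c   = 2 ^ m ∸ 1
    #A  = #𝔹 n (Avoid (2 ^ m))
    #¬A = #𝔹 n (not ∘ Avoid (2 ^ m))
    ratio : #A * suc c ^ suc c ≡ 2 ^ n * c ^ suc c
    ratio = subst (λ J → #A * J ^ J ≡ 2 ^ n * c ^ J) (sym (m+[n∸m]≡n (m^n>0 2 m)))
                  (#Avoid-formula (2 ^ m) n bound)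

  ¬Avoid⇒occursAt : ∀ J s → ¬ T (Avoid J s) → ∃ λ j → 1 ≤ j × j ≤ J × T (occursAt s i m (i + j * m))
  ¬Avoid⇒occursAt zero    s ¬avoid = contradiction _ ¬avoid
  ¬Avoid⇒occursAt (suc J) s ¬avoid with T? (Avoid J s)
  ... | no ¬avoid-J =
    let j , 1≤j , j≤J , occ = ¬Avoid⇒occursAt J s ¬avoid-J in j , 1≤j , m≤n⇒m≤1+n j≤J , occ
  ... | yes avoid-J with T? (occursAt s i m (i + suc J * m))
  ...   | yes occ = suc J , s≤s z≤n , ≤-refl , occ
  ...   | no ¬occ = contradiction (T-∧⁺ (Avoid J s) avoid-J (T-not⁺ ¬occ)) ¬avoid

  𝟙¬Avoid≤ΣNextOcc : ∀ J s → 1 ≤ m →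
    𝟙 (not (Avoid J s)) ≤ Σ< (J * m) (λ d → 𝟙 (NextOcc (i + suc d) s))
  𝟙¬Avoid≤ΣNextOcc J s 1≤m with T? (Avoid J s)
  ... | yes avoid rewrite 𝟙-false (λ ¬avoid → T-not⁻ ¬avoid avoid) = z≤n
  ... | no ¬avoid with ¬Avoid⇒occursAt J s ¬avoid
  ...   | j , 1≤j , j≤J , occ with NextOcc-exists s (m<m+n i (*-mono-≤ 1≤j 1≤m)) occ
  ...     | i′ , i<i′ , i′≤i+jm , next rewrite 𝟙-true (T-not⁺ ¬avoid) = begin
    1                                             ≡⟨ 𝟙-true next ⟨
    𝟙 (NextOcc i′ s)                              ≡⟨ cong (λ p → 𝟙 (NextOcc p s)) i+1+d≡i′ ⟨
    𝟙 (NextOcc (i + suc d) s)                     ≤⟨ Σ<-term (J * m) _ d<Jm ⟩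
    Σ< (J * m) (λ d → 𝟙 (NextOcc (i + suc d) s))  ∎
    where
    open ≤-Reasoning
    d = i′ ∸ suc i
    i+1+d≡i′ : i + suc d ≡ i′
    i+1+d≡i′ = trans (+-suc i d) (m+[n∸m]≡n i<i′)
    d<Jm : d < J * m
    d<Jm = +-cancelˡ-≤ i (suc d) (J * m)
      (≤-trans (≤-reflexive i+1+d≡i′) (≤-trans i′≤i+jm (+-monoʳ-≤ i (*-monoˡ-≤ m j≤J))))

  ΣClosedAt≤𝟙isClosedRepeat : ∀ D s → 1 ≤ m → i + D + m < length s →
    Σ< D (λ d → 𝟙 (ClosedAt (i + suc d) s)) ≤ 𝟙 (isClosedRepeat s i m)
  ΣClosedAt≤𝟙isClosedRepeat D s 1≤m bound = Σ<-𝟙-≤ D (λ d → ClosedAt (i + suc d) s) exclusive implies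
    where
    closed⇒next : ∀ {i′} → T (ClosedAt i′ s) → T (NextOcc i′ s)
    closed⇒next {i′} closed =
      proj₁ (T-∧⁻ (NextOcc i′ s) (proj₁ (T-∧⁻ (NextOcc i′ s ∧ LeftMaximal i′ s) closed)))
    exclusive : ∀ {j k} → j < k → k < D → T (ClosedAt (i + suc j) s) → T (ClosedAt (i + suc k) s) → ⊥
    exclusive j<k _ closed-j closed-k = NextOcc-exclusive s 1≤m (m<m+n i z<s) (+-monoʳ-< i (s<s j<k))
                                                          (closed⇒next closed-j) (closed⇒next closed-k)
    implies : ∀ {k} → k < D → T (ClosedAt (i + suc k) s) → T (isClosedRepeat s i m)
    implies k<D =
      ClosedAt⇒isClosedRepeat s 1≤m (m<m+n i z<s) (≤-<-trans (+-monoˡ-≤ m (+-monoʳ-≤ i k<D)) bound)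

  ΣNextOcc≡4*ΣClosedAt : ∀ n D → 1 ≤ i → 1 ≤ m → i + D + m < n →
    Σ𝔹 n (λ s → Σ< D (λ d → 𝟙 (NextOcc (i + suc d) s)))
      ≡ 4 * Σ𝔹 n (λ s → Σ< D (λ d → 𝟙 (ClosedAt (i + suc d) s)))
  ΣNextOcc≡4*ΣClosedAt n D 1≤i 1≤m bound = begin
    Σ𝔹 n (λ s → Σ< D (λ d → 𝟙 (NextOcc (i + suc d) s)))
      ≡⟨ Σ𝔹-Σ< n D (λ s d → 𝟙 (NextOcc (i + suc d) s)) ⟩
    Σ< D (λ d → #𝔹 n (NextOcc (i + suc d)))
      ≡⟨ Σ<-cong D (λ d<D → 4*#ClosedAt≡#NextOcc n 1≤i 1≤m (m<m+n i z<s)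
                              (≤-<-trans (+-monoˡ-≤ m (+-monoʳ-≤ i d<D)) bound)) ⟨
    Σ< D (λ d → 4 * #𝔹 n (ClosedAt (i + suc d)))
      ≡⟨ Σ<-*ˡ D 4 (λ d → #𝔹 n (ClosedAt (i + suc d))) ⟩
    4 * Σ< D (λ d → #𝔹 n (ClosedAt (i + suc d)))
      ≡⟨ cong (4 *_) (Σ𝔹-Σ< n D (λ s d → 𝟙 (ClosedAt (i + suc d) s))) ⟨
    4 * Σ𝔹 n (λ s → Σ< D (λ d → 𝟙 (ClosedAt (i + suc d) s))) ∎
    where open ≡-Reasoning

  2^n≤8*#isClosedRepeat : ∀ n → 1 ≤ i → 1 ≤ m → i + suc (2 ^ m) * m < n →
    2 ^ n ≤ 8 * #𝔹 n (λ s → isClosedRepeat s i m)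
  2^n≤8*#isClosedRepeat n 1≤i 1≤m bound = begin
    2 ^ n
      ≤⟨ 2^n≤2*#¬Avoid n (<⇒≤ bound) ⟩
    2 * #𝔹 n (not ∘ Avoid J)
      ≤⟨ *-monoʳ-≤ 2 (Σ𝔹-mono n (λ s _ → 𝟙¬Avoid≤ΣNextOcc J s 1≤m)) ⟩
    2 * Σ𝔹 n (λ s → Σ< D (λ d → 𝟙 (NextOcc (i + suc d) s)))
      ≡⟨ cong (2 *_) (ΣNextOcc≡4*ΣClosedAt n D 1≤i 1≤m D-bound) ⟩
    2 * (4 * Σ𝔹 n (λ s → Σ< D (λ d → 𝟙 (ClosedAt (i + suc d) s))))
      ≤⟨ *-monoʳ-≤ 2 (*-monoʳ-≤ 4 (Σ𝔹-mono n (λ s ∣s∣ →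
           ΣClosedAt≤𝟙isClosedRepeat D s 1≤m (subst (i + D + m <_) (sym ∣s∣) D-bound)))) ⟩
    2 * (4 * #𝔹 n (λ s → isClosedRepeat s i m))
      ≡⟨ *-assoc 2 4 (#𝔹 n (λ s → isClosedRepeat s i m)) ⟨
    8 * #𝔹 n (λ s → isClosedRepeat s i m) ∎
    where
    open ≤-Reasoning
    J = 2 ^ m
    D = J * m
    D-bound : i + D + m < n
    D-bound = ≤-<-trans (≤-reflexive (trans (+-assoc i D m) (cong (i +_) (+-comm D m)))) bound

-- All closed repeats

numClosedRepeats-Σ< : ∀ s →
  numClosedRepeats s ≡ Σ< (length s) (λ i → Σ< (suc (length s)) (λ m → 𝟙 (isClosedRepeat s i m)))
numClosedRepeats-Σ< s =
  trans (sum-map-applyUpTo _ id (length s))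
        (Σ<-cong (length s) (λ {i} _ →
          trans (length-filter-≟true (isClosedRepeat s i) (upTo (suc (length s))))
                (sum-map-applyUpTo (𝟙 ∘ isClosedRepeat s i) id (suc (length s)))))

totalClosedRepeats-Σ< : ∀ n →
  totalClosedRepeats n ≡ Σ< n (λ i → Σ< (suc n) (λ m → #𝔹 n (λ s → isClosedRepeat s i m)))
totalClosedRepeats-Σ< n = begin
  totalClosedRepeats n
    ≡⟨ Σ𝔹-cong n (λ s ∣s∣ → trans (numClosedRepeats-Σ< s)
                     (cong (λ l → Σ< l (λ i → Σ< (suc l) (λ m → 𝟙 (isClosedRepeat s i m)))) ∣s∣)) ⟩
  Σ𝔹 n (λ s → Σ< n (λ i → Σ< (suc n) (λ m → 𝟙 (isClosedRepeat s i m))))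
    ≡⟨ Σ𝔹-Σ< n n (λ s i → Σ< (suc n) (λ m → 𝟙 (isClosedRepeat s i m))) ⟩
  Σ< n (λ i → Σ𝔹 n (λ s → Σ< (suc n) (λ m → 𝟙 (isClosedRepeat s i m))))
    ≡⟨ Σ<-cong n (λ {i} _ → Σ𝔹-Σ< n (suc n) (λ s m → 𝟙 (isClosedRepeat s i m))) ⟩
  Σ< n (λ i → Σ< (suc n) (λ m → #𝔹 n (λ s → isClosedRepeat s i m))) ∎
  where open ≡-Reasoning

i+[1+2^m]*m<n : ∀ {n A M i m} → 2 * A ≤ n → 2 * (2 ^ M * 2 ^ M) ≤ n → i ≤ A → m ≤ M →
  i + suc (2 ^ m) * m < n
i+[1+2^m]*m<n {n} {A} {M} {i} {m} 2A≤n 2*4^M≤n i≤A m≤M =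
  *-cancelˡ-< 2 (i + suc (2 ^ m) * m) n (begin-strict
    2 * (i + (m + 2 ^ m * m))    ≡⟨ *-distribˡ-+ 2 i _ ⟩
    2 * i + 2 * (m + 2 ^ m * m)  <⟨ +-mono-≤-< (≤-trans (*-monoʳ-≤ 2 i≤A) 2A≤n) 2X<n ⟩
    n + n                        ≡⟨ cong (n +_) (+-identityʳ n) ⟨
    2 * n                        ∎)
  where
  open ≤-Reasoning
  2X<n : 2 * (m + 2 ^ m * m) < n
  2X<n = <-≤-trans (*-monoʳ-< 2 (m+2^m*m<2^m*2^m m))
                   (≤-trans (*-monoʳ-≤ 2 (*-mono-≤ (^-monoʳ-≤ 2 m≤M) (^-monoʳ-≤ 2 m≤M))) 2*4^M≤n)

A*M*2^n≤8*totalClosedRepeats : ∀ n A M → 2 * A ≤ n → 2 * (2 ^ M * 2 ^ M) ≤ n →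
  A * M * 2 ^ n ≤ 8 * totalClosedRepeats n
A*M*2^n≤8*totalClosedRepeats n A M 2A≤n 2*4^M≤n = begin
  A * M * 2 ^ n
    ≡⟨ *-assoc A M (2 ^ n) ⟩
  A * (M * 2 ^ n)
    ≡⟨ trans (Σ<-const A (Σ< M (λ _ → 2 ^ n))) (cong (A *_) (Σ<-const M (2 ^ n))) ⟨
  Σ< A (λ _ → Σ< M (λ _ → 2 ^ n))
    ≤⟨ Σ<-mono A (λ {i} i<A → Σ<-mono M (λ {m} m<M →
         2^n≤8*#isClosedRepeat (suc i) (suc m) n (s≤s z≤n) (s≤s z≤n)
                               (i+[1+2^m]*m<n 2A≤n 2*4^M≤n i<A m<M))) ⟩
  Σ< A (λ i → Σ< M (λ m → f (suc i) (suc m)))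
    ≤⟨ Σ<-mono A (λ {i} _ → Σ<-tail (f (suc i)) (s≤s M≤n)) ⟩
  Σ< A (λ i → Σ< (suc n) (f (suc i)))
    ≤⟨ Σ<-tail (λ i → Σ< (suc n) (f i)) A<n ⟩
  Σ< n (λ i → Σ< (suc n) (f i))
    ≡⟨ Σ<-cong n (λ {i} _ → Σ<-*ˡ (suc n) 8 (#closed i)) ⟩
  Σ< n (λ i → 8 * Σ< (suc n) (#closed i))
    ≡⟨ Σ<-*ˡ n 8 (λ i → Σ< (suc n) (#closed i)) ⟩
  8 * Σ< n (λ i → Σ< (suc n) (#closed i))
    ≡⟨ cong (8 *_) (totalClosedRepeats-Σ< n) ⟨
  8 * totalClosedRepeats n ∎
  where
  open ≤-Reasoning
  open Repeat using (2^n≤8*#isClosedRepeat)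
  #closed : ℕ → ℕ → ℕ
  #closed i m = #𝔹 n (λ s → isClosedRepeat s i m)
  f : ℕ → ℕ → ℕ
  f i m = 8 * #closed i m
  2≤n : 2 ≤ n
  2≤n = ≤-trans (*-monoʳ-≤ 2 (*-mono-≤ (m^n>0 2 M) (m^n>0 2 M))) 2*4^M≤n
  A<n : A < n
  A<n = 2*m≤n⇒m<n 2A≤n (≤-trans (s≤s z≤n) 2≤n)
  M≤n : M ≤ n
  M≤n = ≤-trans (<⇒≤ (n<2^n M))
                (≤-trans (m≤m*n (2 ^ M) (2 ^ M) {{m^n≢0 2 M}}) (≤-trans (m≤n*m _ 2) 2*4^M≤n))

n*⌈log₂n⌉*2^n≤256*totalClosedRepeats : ∀ n → 16 ≤ n → n * ⌈log₂ n ⌉ * 2 ^ n ≤ 256 * totalClosedRepeats n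
n*⌈log₂n⌉*2^n≤256*totalClosedRepeats n 16≤n = begin
  n * K * 2 ^ n
    ≤⟨ *-monoˡ-≤ (2 ^ n) (*-mono-≤ (m≤2*[m/n]*n n 2 2≤n) (m≤2*[m/n]*n K 4 4≤K)) ⟩
  2 * A * 2 * (2 * M * 4) * 2 ^ n
    ≡⟨ regroup A M (2 ^ n) ⟩
  32 * (A * M * 2 ^ n)
    ≤⟨ *-monoʳ-≤ 32 (A*M*2^n≤8*totalClosedRepeats n A M 2A≤n 2*4^M≤n) ⟩
  32 * (8 * totalClosedRepeats n)
    ≡⟨ *-assoc 32 8 (totalClosedRepeats n) ⟨
  256 * totalClosedRepeats n ∎
  where
  open ≤-Reasoning
  K = ⌈log₂ n ⌉
  A = n / 2
  M = K / 4
  regroup : ∀ a b x → 2 * a * 2 * (2 * b * 4) * x ≡ 32 * (a * b * x)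
  regroup = solve-∀
  2≤n : 2 ≤ n
  2≤n = ≤-trans (s≤s (s≤s z≤n)) 16≤n
  4≤K : 4 ≤ K
  4≤K = ≤⌈log₂⌉ 16≤n
  2A≤n : 2 * A ≤ n
  2A≤n = ≤-trans (≤-reflexive (*-comm 2 A)) (m/n*n≤m n 2)
  2*4^M≤n : 2 * (2 ^ M * 2 ^ M) ≤ n
  2*4^M≤n = ≤-trans (≤-reflexive (cong (2 *_) (sym (^-distribˡ-+-* 2 M M))))
                    (<⇒≤ (<⌈log₂⌉⇒2^<n (≤-trans (2+2m≤4m M (m≥n⇒m/n>0 4≤K)) (m/n*n≤m K 4))))

theorem2 : ∃ λ p → ∃ λ q → ∃ λ n₀ → 0 < p × 0 < q ×
    (∀ n → n₀ ≤ n → p * (n * ⌈log₂ n ⌉ * 2 ^ n) ≤ q * totalClosedRepeats n)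
theorem2 = 1 , 256 , 16 , z<s , z<s , λ n 16≤n →
  ≤-trans (≤-reflexive (*-identityˡ _)) (n*⌈log₂n⌉*2^n≤256*totalClosedRepeats n 16≤n)
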